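{- Let $q\ge 2$ be an integer and let $p(x)=\sum_{i=0}^{d}a_ix^i\in\mathbf{C}[x]$ with $a_0=p(0)=1$ and $d=\deg p\ge 1$; let $k\in\mathbf{N}$ satisfy $q^{k-1}<d\le q^k$. Write $\prod_{s=0}^{\infty}p(x^{q^{s}})=\sum_{n\ge 0}c_nx^n$ and set $c_n=0$ for $n<0$. Then for every $i$ with $0\le i\le q-1$ and every $j$ with $0\le j\le 2q^k$, there are constants $\lambda_{i,j,t}\in\mathbf{C}$ ($0\le t<2q^k$), independent of $n$, such that $$c_{qn+i-j}=\sum_{t=0}^{2q^k-1}\lambda_{i,j,t}\,c_{n-t}\qquad\text{for all } n\in\mathbf{N}.$$
   Context: The infinite product is a formal power series, well defined since $p(0)=1$. -}

module Defs where

open import Algebra.Bundles using (CommutativeRing)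
open import Data.Nat as ℕ using (ℕ; zero; suc; _∸_; _^_; _≟_)
open import Data.Integer as ℤ using (ℤ; +_; -[1+_])
open import Relation.Nullary using (yes; no)

module Series {c ℓ} (R : CommutativeRing c ℓ) where
  open CommutativeRing R public

  FPS : Set c
  FPS = ℕ → Carrier

  sumTo : ℕ → (ℕ → Carrier) → Carrier
  sumTo zero    f = 0#
  sumTo (suc n) f = sumTo n f + f n

  _⊛_ : FPS → FPS → FPS
  (f ⊛ g) n = sumTo (suc n) (λ i → f i * g (n ∸ i))

  oneS : FPS
  oneS zero    = 1#
  oneS (suc _) = 0#

  ifEq : ℕ → ℕ → Carrier → Carrier
  ifEq x y v with x ≟ y
  ... | yes _ = v
  ... | no  _ = 0#

  -- substitution x ↦ x^m :  coefficient of x^n in a(x^m) is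
  -- Σ_{i ≤ n, i*m = n} a_i
  substPow : FPS → ℕ → FPS
  substPow a m n = sumTo (suc n) (λ i → ifEq (i ℕ.* m) n (a i))

  prodTo : ℕ → (ℕ → FPS) → FPS
  prodTo zero    F = oneS
  prodTo (suc n) F = prodTo n F ⊛ F n

  -- c_n = coefficient of x^n in  ∏_{s ≥ 0} p(x^{q^s}).
  -- For q ≥ 2 and p(0) = 1 the factors with s > n are ≡ 1 mod x^{n+1},
  -- so the coefficient of x^n is that of the partial product over s ≤ n.
  infCoeff : FPS → ℕ → FPS
  infCoeff a q n = prodTo (suc n) (λ s → substPow a (q ^ s)) n

  cZ : FPS → ℕ → ℤ → Carrier
  cZ a q (+ n)     = infCoeff a q n
  cZ a q -[1+ n ]  = 0#

{-# OPTIONS --safe #-}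
-- Since p(x^{q^N}) ≡ 1 mod x^{q^N} and N < q^N, the coefficients of the partial
-- products stabilise, and the product c(x) = Σ c_n x^n satisfies c(x) = p(x) c(x^q),
-- i.e. c_m = Σ_u c_u a_{m-qu}.  For m = qn+i-j and u = n-t this reads
-- c_{qn+i-j} = Σ_{t ≤ n} a_{qt+i-j} c_{n-t}, so λ_t = a_{qt+i-j} works; as deg p ≤ q^k
-- and j ≤ 2q^k, λ_t = 0 once t ≥ 2q^k, so the sum may be cut off there.
module Submission where

open import Defs
open import Algebra.Bundles using (CommutativeRing)
open import Data.Nat as ℕ
  using (ℕ; zero; suc; _∸_; _^_; _≟_; NonZero; ≤′-refl; ≤′-step)
import Data.Nat.Properties as ℕₚ
open import Data.Nat.Divisibility
  using (_∣_; divides; _∣?_; ∣⇒≤; n∣m*n; m∣m*n; ∣-trans; ∣m+n∣m⇒∣n; ∣m∸n∣n⇒∣m; *-cancelʳ-∣)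
import Data.Nat.Tactic.RingSolver as ℕ-Solver
open import Data.Integer as ℤ using (ℤ; +_; -[1+_]; +<+)
import Data.Integer.Properties as ℤₚ
import Data.Integer.Tactic.RingSolver as ℤ-Solver
open import Data.Product using (∃; _,_)
open import Data.Sum using (inj₁; inj₂)
open import Function using (_∘_)
open import Relation.Nullary using (¬_; yes; no; contradiction)
open import Relation.Binary.PropositionalEquality as ≡ using (_≡_; _≢_)

module _ where
  open ℕₚ.≤-Reasoning

  2≤⇒nonZero : ∀ {m} → 2 ℕ.≤ m → NonZero m
  2≤⇒nonZero 2≤m = ℕ.>-nonZero (ℕₚ.≤-trans (ℕₚ.n≤1+n 1) 2≤m)

  2*n≡n+n : ∀ n → 2 ℕ.* n ≡ n ℕ.+ n
  2*n≡n+n n = ≡.cong (n ℕ.+_) (ℕₚ.+-identityʳ n)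

  n<m^n : ∀ {m} → 2 ℕ.≤ m → ∀ n → n ℕ.< m ^ n
  n<m^n 2≤m zero = ℕ.s≤s ℕ.z≤n
  n<m^n {m} 2≤m (suc n) = begin-strict
    1 ℕ.+ n          <⟨ ℕₚ.+-mono-≤-< (ℕₚ.m^n>0 m {{2≤⇒nonZero 2≤m}} n) (n<m^n 2≤m n) ⟩
    m ^ n ℕ.+ m ^ n  ≡⟨ 2*n≡n+n (m ^ n) ⟨
    2 ℕ.* m ^ n      ≤⟨ ℕₚ.*-monoˡ-≤ (m ^ n) 2≤m ⟩
    m ^ suc n        ∎

  d+j<q*t : ∀ {q d Q j t} → 2 ℕ.≤ q → 1 ℕ.≤ d → d ℕ.≤ Q → j ℕ.≤ 2 ℕ.* Q → 2 ℕ.* Q ℕ.≤ t →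
            d ℕ.+ j ℕ.< q ℕ.* t
  d+j<q*t {q} {d} {Q} {j} {t} 2≤q 1≤d d≤Q j≤2Q 2Q≤t = begin-strict
    d ℕ.+ j  <⟨ ℕₚ.+-mono-<-≤ d<t (ℕₚ.≤-trans j≤2Q 2Q≤t) ⟩
    t ℕ.+ t  ≡⟨ 2*n≡n+n t ⟨
    2 ℕ.* t  ≤⟨ ℕₚ.*-monoˡ-≤ t 2≤q ⟩
    q ℕ.* t  ∎
    where
    d<t : d ℕ.< t
    d<t = begin-strict
      d        ≤⟨ d≤Q ⟩
      Q        <⟨ ℕₚ.m<m+n Q (ℕₚ.≤-trans 1≤d d≤Q) ⟩
      Q ℕ.+ Q  ≡⟨ 2*n≡n+n Q ⟨
      2 ℕ.* Q  ≤⟨ 2Q≤t ⟩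
      t        ∎

  q*n+i<[1+n]*q : ∀ {q i} n → i ℕ.< q → q ℕ.* n ℕ.+ i ℕ.< suc n ℕ.* q
  q*n+i<[1+n]*q {q} {i} n i<q = begin-strict
    q ℕ.* n ℕ.+ i  <⟨ ℕₚ.+-monoʳ-< (q ℕ.* n) i<q ⟩
    q ℕ.* n ℕ.+ q  ≡⟨ ℕₚ.+-comm (q ℕ.* n) q ⟩
    q ℕ.+ q ℕ.* n  ≡⟨ ≡.cong (q ℕ.+_) (ℕₚ.*-comm q n) ⟩
    suc n ℕ.* q    ∎

  q*n+i≡q*t+i+[n∸t]*q : ∀ q i {n t} → t ℕ.≤ n → q ℕ.* n ℕ.+ i ≡ q ℕ.* t ℕ.+ i ℕ.+ (n ∸ t) ℕ.* q
  q*n+i≡q*t+i+[n∸t]*q q i {n} {t} t≤n = begin-equality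
    q ℕ.* n ℕ.+ i                          ≡⟨ ≡.cong (λ m → q ℕ.* m ℕ.+ i) (ℕₚ.m+[n∸m]≡n t≤n) ⟨
    q ℕ.* (t ℕ.+ (n ∸ t)) ℕ.+ i            ≡⟨ rearrange q t (n ∸ t) i ⟩
    q ℕ.* t ℕ.+ i ℕ.+ (n ∸ t) ℕ.* q        ∎
    where
    rearrange : ∀ q t s i → q ℕ.* (t ℕ.+ s) ℕ.+ i ≡ q ℕ.* t ℕ.+ i ℕ.+ s ℕ.* q
    rearrange = ℕ-Solver.solve-∀

x+y-z-y≡x-z : ∀ x y z → x ℤ.+ y ℤ.- z ℤ.- y ≡ x ℤ.- z
x+y-z-y≡x-z = ℤ-Solver.solve-∀

module SeriesProperties {c ℓ} (R : CommutativeRing c ℓ) where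
  open Series R
  open import Algebra.Properties.CommutativeSemigroup +-commutativeSemigroup
    using () renaming (interchange to +-interchange)
  open import Relation.Binary.Reasoning.Setoid setoid

  sumTo-cong : ∀ n {f g : ℕ → Carrier} → (∀ i → i ℕ.< n → f i ≈ g i) → sumTo n f ≈ sumTo n g
  sumTo-cong zero    f≈g = refl
  sumTo-cong (suc n) f≈g = +-cong (sumTo-cong n (λ i i<n → f≈g i (ℕₚ.m<n⇒m<1+n i<n))) (f≈g n ℕₚ.≤-refl)

  sumTo-zero : ∀ n {f : ℕ → Carrier} → (∀ i → i ℕ.< n → f i ≈ 0#) → sumTo n f ≈ 0#
  sumTo-zero zero    f≈0 = refl
  sumTo-zero (suc n) f≈0 =
    trans (+-cong (sumTo-zero n (λ i i<n → f≈0 i (ℕₚ.m<n⇒m<1+n i<n))) (f≈0 n ℕₚ.≤-refl)) (+-identityʳ 0#)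

  sumTo-+ : ∀ n (f g : ℕ → Carrier) → sumTo n (λ i → f i + g i) ≈ sumTo n f + sumTo n g
  sumTo-+ zero    f g = sym (+-identityʳ 0#)
  sumTo-+ (suc n) f g = trans (+-congʳ (sumTo-+ n f g)) (+-interchange (sumTo n f) (sumTo n g) (f n) (g n))

  sumTo-*ˡ : ∀ n x (f : ℕ → Carrier) → x * sumTo n f ≈ sumTo n (λ i → x * f i)
  sumTo-*ˡ zero    x f = zeroʳ x
  sumTo-*ˡ (suc n) x f = trans (distribˡ x _ _) (+-congʳ (sumTo-*ˡ n x f))

  sumTo-*ʳ : ∀ n x (f : ℕ → Carrier) → sumTo n f * x ≈ sumTo n (λ i → f i * x)
  sumTo-*ʳ zero    x f = zeroˡ x
  sumTo-*ʳ (suc n) x f = trans (distribʳ x _ _) (+-congʳ (sumTo-*ʳ n x f))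

  sumTo-unfoldˡ : ∀ n (f : ℕ → Carrier) → sumTo (suc n) f ≈ f 0 + sumTo n (f ∘ suc)
  sumTo-unfoldˡ zero    f = trans (+-identityˡ _) (sym (+-identityʳ _))
  sumTo-unfoldˡ (suc n) f = trans (+-congʳ (sumTo-unfoldˡ n f)) (+-assoc _ _ _)

  sumTo-+-split : ∀ m n (f : ℕ → Carrier) → sumTo (m ℕ.+ n) f ≈ sumTo m f + sumTo n (λ r → f (m ℕ.+ r))
  sumTo-+-split m zero    f rewrite ℕₚ.+-identityʳ m = sym (+-identityʳ _)
  sumTo-+-split m (suc n) f rewrite ℕₚ.+-suc m n = trans (+-congʳ (sumTo-+-split m n f)) (+-assoc _ _ _)

  sumTo-extend : ∀ {m n} {f : ℕ → Carrier} → m ℕ.≤ n → (∀ i → m ℕ.≤ i → f i ≈ 0#) → sumTo n f ≈ sumTo m f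
  sumTo-extend {m} {n} {f} m≤n f≈0 = begin
    sumTo n f                                                ≡⟨ ≡.cong (λ k → sumTo k f) (ℕₚ.m+[n∸m]≡n m≤n) ⟨
    sumTo (m ℕ.+ (n ∸ m)) f                                  ≈⟨ sumTo-+-split m (n ∸ m) f ⟩
    sumTo m f + sumTo (n ∸ m) (λ r → f (m ℕ.+ r))            ≈⟨ +-congˡ (sumTo-zero (n ∸ m) (λ r _ → f≈0 (m ℕ.+ r) (ℕₚ.m≤m+n m r))) ⟩
    sumTo m f + 0#                                           ≈⟨ +-identityʳ _ ⟩
    sumTo m f                                                ∎

  sumTo-vanishing-tail : ∀ {m n} {f : ℕ → Carrier} →
    (∀ i → m ℕ.≤ i → f i ≈ 0#) → (∀ i → n ℕ.≤ i → f i ≈ 0#) → sumTo m f ≈ sumTo n f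
  sumTo-vanishing-tail {m} {n} f≈0₁ f≈0₂ with ℕₚ.≤-total m n
  ... | inj₁ m≤n = sym (sumTo-extend m≤n f≈0₁)
  ... | inj₂ n≤m = sumTo-extend n≤m f≈0₂

  sumTo-single : ∀ n i₀ {f : ℕ → Carrier} → i₀ ℕ.< n →
    (∀ i → i ℕ.< n → i ≢ i₀ → f i ≈ 0#) → sumTo n f ≈ f i₀
  sumTo-single zero    i₀ ()     f≈0
  sumTo-single (suc n) i₀ i₀<1+n f≈0 with n ≟ i₀
  ... | yes ≡.refl = trans (+-congʳ (sumTo-zero n (λ i i<n → f≈0 i (ℕₚ.m<n⇒m<1+n i<n) (ℕₚ.<⇒≢ i<n)))) (+-identityˡ _)
  ... | no n≢i₀ = trans (+-congˡ (f≈0 n ℕₚ.≤-refl n≢i₀)) (trans (+-identityʳ _)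
        (sumTo-single n i₀ (ℕₚ.≤∧≢⇒< (ℕₚ.≤-pred i₀<1+n) (n≢i₀ ∘ ≡.sym))
          (λ i i<n → f≈0 i (ℕₚ.m<n⇒m<1+n i<n))))

  sumTo-reverse : ∀ n (f : ℕ → Carrier) → sumTo (suc n) f ≈ sumTo (suc n) (λ i → f (n ∸ i))
  sumTo-reverse zero    f = refl
  sumTo-reverse (suc n) f = begin
    sumTo (suc n) f + f (suc n)                  ≈⟨ +-congʳ (sumTo-reverse n f) ⟩
    sumTo (suc n) (λ i → f (n ∸ i)) + f (suc n)  ≈⟨ +-comm _ _ ⟩
    f (suc n) + sumTo (suc n) (λ i → f (n ∸ i))  ≈⟨ sumTo-unfoldˡ (suc n) (λ i → f (suc n ∸ i)) ⟨
    sumTo (suc (suc n)) (λ i → f (suc n ∸ i))    ∎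

  sumTo-blocks : ∀ N m (f : ℕ → Carrier) → sumTo (N ℕ.* m) f ≈ sumTo N (λ u → sumTo m (λ r → f (u ℕ.* m ℕ.+ r)))
  sumTo-blocks zero    m f = refl
  sumTo-blocks (suc N) m f rewrite ℕₚ.+-comm m (N ℕ.* m) =
    trans (sumTo-+-split (N ℕ.* m) m f) (+-congʳ (sumTo-blocks N m f))

  sumTo-multiples : ∀ N m .{{_ : NonZero m}} {f : ℕ → Carrier} → (∀ x → ¬ m ∣ x → f x ≈ 0#) →
    sumTo (N ℕ.* m) f ≈ sumTo N (λ u → f (u ℕ.* m))
  sumTo-multiples N m {f} f≈0 = trans (sumTo-blocks N m f) (sumTo-cong N (λ u _ → block u))
    where
    block : ∀ u → sumTo m (λ r → f (u ℕ.* m ℕ.+ r)) ≈ f (u ℕ.* m)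
    block u = trans
      (sumTo-single m 0 (ℕ.>-nonZero⁻¹ m) (λ r r<m r≢0 → f≈0 _ (λ m∣um+r →
        ℕₚ.<⇒≱ r<m (∣⇒≤ {{ℕ.≢-nonZero r≢0}} (∣m+n∣m⇒∣n m∣um+r (n∣m*n u))))))
      (reflexive (≡.cong f (ℕₚ.+-identityʳ (u ℕ.* m))))

  sumTo-triangle : ∀ N (G : ℕ → ℕ → Carrier) →
    sumTo N (λ s → sumTo (suc s) (λ i → G i (s ∸ i))) ≈ sumTo N (λ i → sumTo (N ∸ i) (G i))
  sumTo-triangle zero    G = refl
  sumTo-triangle (suc N) G = begin
    sumTo N (λ s → sumTo (suc s) (λ i → G i (s ∸ i))) + sumTo (suc N) (λ i → G i (N ∸ i))
      ≈⟨ +-congʳ (sumTo-triangle N G) ⟩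
    sumTo N (λ i → sumTo (N ∸ i) (G i)) + sumTo (suc N) (λ i → G i (N ∸ i))
      ≈⟨ +-congʳ (trans (+-congˡ (reflexive (≡.cong (λ k → sumTo k (G N)) (ℕₚ.n∸n≡0 N)))) (+-identityʳ _)) ⟨
    sumTo (suc N) (λ i → sumTo (N ∸ i) (G i)) + sumTo (suc N) (λ i → G i (N ∸ i))
      ≈⟨ sumTo-+ (suc N) _ _ ⟨
    sumTo (suc N) (λ i → sumTo (N ∸ i) (G i) + G i (N ∸ i))
      ≈⟨ sumTo-cong (suc N) (λ i i<1+N → reflexive (≡.cong (λ k → sumTo k (G i)) (≡.sym (ℕₚ.+-∸-assoc 1 (ℕₚ.≤-pred i<1+N))))) ⟩
    sumTo (suc N) (λ i → sumTo (suc N ∸ i) (G i)) ∎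

  infix 4 _≋_
  _≋_ : FPS → FPS → Set ℓ
  f ≋ g = ∀ n → f n ≈ g n

  ⊛-cong-≤ : ∀ {f f′} g n → (∀ k → k ℕ.≤ n → f k ≈ f′ k) → (f ⊛ g) n ≈ (f′ ⊛ g) n
  ⊛-cong-≤ g n f≈f′ = sumTo-cong (suc n) (λ i i<1+n → *-congʳ (f≈f′ i (ℕₚ.≤-pred i<1+n)))

  ⊛-cong : ∀ {f f′ g g′} → f ≋ f′ → g ≋ g′ → f ⊛ g ≋ f′ ⊛ g′
  ⊛-cong f≈f′ g≈g′ n = sumTo-cong (suc n) (λ i _ → *-cong (f≈f′ i) (g≈g′ (n ∸ i)))

  ⊛-comm : ∀ f g → f ⊛ g ≋ g ⊛ f
  ⊛-comm f g n = trans (sumTo-reverse n _) (sumTo-cong (suc n) (λ i i<1+n →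
    trans (*-comm _ _) (*-congʳ (reflexive (≡.cong g (ℕₚ.m∸[m∸n]≡n (ℕₚ.≤-pred i<1+n)))))))

  ⊛-identityʳ : ∀ f → f ⊛ oneS ≋ f
  ⊛-identityʳ f n = trans (sumTo-single (suc n) n ℕₚ.≤-refl off-diagonal) (on-diagonal n)
    where
    on-diagonal : ∀ n → f n * oneS (n ∸ n) ≈ f n
    on-diagonal n rewrite ℕₚ.n∸n≡0 n = *-identityʳ (f n)
    off-diagonal : ∀ i → i ℕ.< suc n → i ≢ n → f i * oneS (n ∸ i) ≈ 0#
    off-diagonal i i<1+n i≢n with n ∸ i in n∸i≡k
    ... | zero  = contradiction (ℕₚ.m∸n≡0⇒m≤n n∸i≡k) (ℕₚ.<⇒≱ (ℕₚ.≤∧≢⇒< (ℕₚ.≤-pred i<1+n) i≢n))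
    ... | suc _ = zeroʳ (f i)

  ⊛-identityˡ : ∀ f → oneS ⊛ f ≋ f
  ⊛-identityˡ f n = trans (⊛-comm oneS f n) (⊛-identityʳ f n)

  ⊛-assoc : ∀ f g h → (f ⊛ g) ⊛ h ≋ f ⊛ (g ⊛ h)
  ⊛-assoc f g h n = begin
    sumTo (suc n) (λ s → sumTo (suc s) (λ i → f i * g (s ∸ i)) * h (n ∸ s))
      ≈⟨ sumTo-cong (suc n) (λ s s<1+n → trans (sumTo-*ʳ (suc s) _ _) (sumTo-cong (suc s) (λ i i<1+s →
           trans (*-assoc _ _ _) (*-congˡ (*-congˡ (reflexive (≡.cong h (∸-split (ℕₚ.≤-pred i<1+s))))))))) ⟩
    sumTo (suc n) (λ s → sumTo (suc s) (λ i → G i (s ∸ i)))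
      ≈⟨ sumTo-triangle (suc n) G ⟩
    sumTo (suc n) (λ i → sumTo (suc n ∸ i) (G i))
      ≈⟨ sumTo-cong (suc n) (λ i i<1+n → reflexive (≡.cong (λ k → sumTo k (G i)) (ℕₚ.+-∸-assoc 1 (ℕₚ.≤-pred i<1+n)))) ⟩
    sumTo (suc n) (λ i → sumTo (suc (n ∸ i)) (G i))
      ≈⟨ sumTo-cong (suc n) (λ i _ → sumTo-*ˡ (suc (n ∸ i)) (f i) _) ⟨
    sumTo (suc n) (λ i → f i * (g ⊛ h) (n ∸ i)) ∎
    where
    G : ℕ → ℕ → Carrier
    G i j = f i * (g j * h (n ∸ i ∸ j))
    ∸-split : ∀ {s i} → i ℕ.≤ s → n ∸ s ≡ n ∸ i ∸ (s ∸ i)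
    ∸-split {s} {i} i≤s =
      ≡.trans (≡.cong (n ∸_) (≡.sym (ℕₚ.m+[n∸m]≡n i≤s))) (≡.sym (ℕₚ.∸-+-assoc n i (s ∸ i)))

  prodTo-cong : ∀ n {F G : ℕ → FPS} → (∀ s → F s ≋ G s) → prodTo n F ≋ prodTo n G
  prodTo-cong zero    F≈G k = refl
  prodTo-cong (suc n) F≈G = ⊛-cong (prodTo-cong n F≈G) (F≈G n)

  prodTo-unfoldˡ : ∀ n (F : ℕ → FPS) → prodTo (suc n) F ≋ F 0 ⊛ prodTo n (F ∘ suc)
  prodTo-unfoldˡ zero    F k = trans (⊛-identityˡ (F 0) k) (sym (⊛-identityʳ (F 0) k))
  prodTo-unfoldˡ (suc n) F k = begin
    (prodTo (suc n) F ⊛ F (suc n)) k              ≈⟨ ⊛-cong {g = F (suc n)} (prodTo-unfoldˡ n F) (λ _ → refl) k ⟩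
    ((F 0 ⊛ prodTo n (F ∘ suc)) ⊛ F (suc n)) k    ≈⟨ ⊛-assoc (F 0) (prodTo n (F ∘ suc)) (F (suc n)) k ⟩
    (F 0 ⊛ prodTo (suc n) (F ∘ suc)) k            ∎

  ifEq-≡ : ∀ x {y} v → x ≡ y → ifEq x y v ≈ v
  ifEq-≡ x {y} v x≡y with x ≟ y
  ... | yes _   = refl
  ... | no  x≢y = contradiction x≡y x≢y

  ifEq-≢ : ∀ {x y} v → x ≢ y → ifEq x y v ≈ 0#
  ifEq-≢ {x} {y} v x≢y with x ≟ y
  ... | yes x≡y = contradiction x≡y x≢y
  ... | no  _   = refl

  ifEq-cong : ∀ x y {v w} → v ≈ w → ifEq x y v ≈ ifEq x y w
  ifEq-cong x y v≈w with x ≟ y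
  ... | yes _ = v≈w
  ... | no  _ = refl

  substPow-multiple : ∀ f m .{{_ : NonZero m}} i → substPow f m (i ℕ.* m) ≈ f i
  substPow-multiple f m i = trans
    (sumTo-single (suc (i ℕ.* m)) i (ℕ.s≤s (ℕₚ.m≤m*n i m))
      (λ i′ _ i′≢i → ifEq-≢ (f i′) (i′≢i ∘ ℕₚ.*-cancelʳ-≡ i′ i m)))
    (ifEq-≡ (i ℕ.* m) (f i) ≡.refl)

  substPow-nonmultiple : ∀ f m {n} → ¬ m ∣ n → substPow f m n ≈ 0#
  substPow-nonmultiple f m {n} m∤n =
    sumTo-zero (suc n) (λ i _ → ifEq-≢ (f i) (λ i*m≡n → m∤n (divides i (≡.sym i*m≡n))))

  substPow-below : ∀ f m {k} → 0 ℕ.< k → k ℕ.< m → substPow f m k ≈ 0#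
  substPow-below f m 0<k k<m = substPow-nonmultiple f m (λ m∣k → ℕₚ.<⇒≱ k<m (∣⇒≤ {{ℕ.>-nonZero 0<k}} m∣k))

  substPow-cong-≤ : ∀ {f g} m n → (∀ k → k ℕ.≤ n → f k ≈ g k) → substPow f m n ≈ substPow g m n
  substPow-cong-≤ m n f≈g = sumTo-cong (suc n) (λ i i<1+n → ifEq-cong (i ℕ.* m) n (f≈g i (ℕₚ.≤-pred i<1+n)))

  substPow-1 : ∀ f → substPow f 1 ≋ f
  substPow-1 f n = ≡.subst (λ k → substPow f 1 k ≈ f n) (ℕₚ.*-identityʳ n) (substPow-multiple f 1 n)

  substPow-oneS : ∀ m .{{_ : NonZero m}} → substPow oneS m ≋ oneS
  substPow-oneS m zero = +-identityˡ 1#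
  substPow-oneS m (suc n) with m ∣? suc n
  ... | no  m∤n = substPow-nonmultiple oneS m m∤n
  ... | yes (divides (suc k) 1+n≡) = ≡.subst (λ x → substPow oneS m x ≈ 0#) (≡.sym 1+n≡) (substPow-multiple oneS m (suc k))

  substPow-⊛ : ∀ f g m .{{_ : NonZero m}} → substPow (f ⊛ g) m ≋ substPow f m ⊛ substPow g m
  substPow-⊛ f g m n with m ∣? n
  ... | yes (divides k ≡.refl) = sym (begin
    sumTo (suc (k ℕ.* m)) h                   ≈⟨ +-congʳ (sumTo-multiples k m nonmultiple) ⟩
    sumTo (suc k) (λ u → h (u ℕ.* m))         ≈⟨ sumTo-cong (suc k) (λ u u<1+k → multiple (ℕₚ.≤-pred u<1+k)) ⟩
    sumTo (suc k) (λ u → f u * g (k ∸ u))     ≈⟨ substPow-multiple (f ⊛ g) m k ⟨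
    substPow (f ⊛ g) m (k ℕ.* m)              ∎)
    where
    h : ℕ → Carrier
    h x = substPow f m x * substPow g m (k ℕ.* m ∸ x)
    nonmultiple : ∀ x → ¬ m ∣ x → h x ≈ 0#
    nonmultiple x m∤x = trans (*-congʳ (substPow-nonmultiple f m m∤x)) (zeroˡ _)
    multiple : ∀ {u} → u ℕ.≤ k → h (u ℕ.* m) ≈ f u * g (k ∸ u)
    multiple {u} u≤k rewrite ≡.sym (ℕₚ.*-distribʳ-∸ m k u) =
      *-cong (substPow-multiple f m u) (substPow-multiple g m (k ∸ u))
  ... | no m∤n = trans (substPow-nonmultiple (f ⊛ g) m m∤n)
                   (sym (sumTo-zero (suc n) (λ x x<1+n → term (ℕₚ.≤-pred x<1+n))))
    where
    term : ∀ {x} → x ℕ.≤ n → substPow f m x * substPow g m (n ∸ x) ≈ 0#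
    term {x} x≤n with m ∣? x
    ... | no  m∤x = trans (*-congʳ (substPow-nonmultiple f m m∤x)) (zeroˡ _)
    ... | yes m∣x = trans (*-congˡ (substPow-nonmultiple g m (λ m∣n∸x → m∤n (∣m∸n∣n⇒∣m m x≤n m∣n∸x m∣x))))
                          (zeroʳ _)

  substPow-substPow : ∀ f m r .{{_ : NonZero m}} .{{_ : NonZero r}} →
    substPow (substPow f m) r ≋ substPow f (r ℕ.* m)
  substPow-substPow f m r n with r ∣? n
  ... | no r∤n = trans (substPow-nonmultiple _ r r∤n)
                   (sym (substPow-nonmultiple f (r ℕ.* m) (r∤n ∘ ∣-trans (m∣m*n m))))
  ... | yes (divides k ≡.refl) with m ∣? k
  ...   | yes (divides i ≡.refl) = begin
    substPow (substPow f m) r (i ℕ.* m ℕ.* r)   ≈⟨ substPow-multiple _ r (i ℕ.* m) ⟩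
    substPow f m (i ℕ.* m)                      ≈⟨ substPow-multiple f m i ⟩
    f i                                         ≈⟨ substPow-multiple f (r ℕ.* m) {{ℕₚ.m*n≢0 r m}} i ⟨
    substPow f (r ℕ.* m) (i ℕ.* (r ℕ.* m))      ≡⟨ ≡.cong (λ x → substPow f (r ℕ.* m) (i ℕ.* x)) (ℕₚ.*-comm r m) ⟩
    substPow f (r ℕ.* m) (i ℕ.* (m ℕ.* r))      ≡⟨ ≡.cong (substPow f (r ℕ.* m)) (ℕₚ.*-assoc i m r) ⟨
    substPow f (r ℕ.* m) (i ℕ.* m ℕ.* r)        ∎
  ...   | no m∤k = trans (substPow-multiple _ r k) (trans (substPow-nonmultiple f m m∤k)
                    (sym (substPow-nonmultiple f (r ℕ.* m) (m∤k ∘ *-cancelʳ-∣ r ∘ ≡.subst (_∣ k ℕ.* r) (ℕₚ.*-comm r m)))))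

  substPow-prodTo : ∀ n (F : ℕ → FPS) m .{{_ : NonZero m}} →
    substPow (prodTo n F) m ≋ prodTo n (λ s → substPow (F s) m)
  substPow-prodTo zero    F m = substPow-oneS m
  substPow-prodTo (suc n) F m k =
    trans (substPow-⊛ (prodTo n F) (F n) m k) (⊛-cong {g = substPow (F n) m} (substPow-prodTo n F m) (λ _ → refl) k)

  ⊛-identityʳ-below : ∀ f {g} K → g 0 ≈ 1# → (∀ k → 0 ℕ.< k → k ℕ.< K → g k ≈ 0#) →
    ∀ n → n ℕ.< K → (f ⊛ g) n ≈ f n
  ⊛-identityʳ-below f {g} K g₀≈1 g≈0 n n<K = begin
    sumTo n (λ i → f i * g (n ∸ i)) + f n * g (n ∸ n)  ≈⟨ +-cong (sumTo-zero n lower) diagonal ⟩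
    0# + f n                                           ≈⟨ +-identityˡ (f n) ⟩
    f n                                                ∎
    where
    lower : ∀ i → i ℕ.< n → f i * g (n ∸ i) ≈ 0#
    lower i i<n =
      trans (*-congˡ (g≈0 (n ∸ i) (ℕₚ.m<n⇒0<n∸m i<n) (ℕₚ.≤-<-trans (ℕₚ.m∸n≤m n i) n<K))) (zeroʳ (f i))
    diagonal : f n * g (n ∸ n) ≈ f n
    diagonal rewrite ℕₚ.n∸n≡0 n = trans (*-congˡ g₀≈1) (*-identityʳ (f n))

  coeffℤ : FPS → ℤ → Carrier
  coeffℤ f (+ n)    = f n
  coeffℤ f -[1+ n ] = 0#

  coeffℤ-∸ : ∀ f {m n} → n ℕ.≤ m → coeffℤ f (+ m ℤ.- + n) ≡ f (m ∸ n)
  coeffℤ-∸ f {m} {n} n≤m rewrite ℤₚ.m-n≡m⊖n m n | ℤₚ.⊖-≥ n≤m = ≡.refl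

  coeffℤ-< : ∀ f {m n} → m ℕ.< n → coeffℤ f (+ m ℤ.- + n) ≡ 0#
  coeffℤ-< f {m} {n} m<n rewrite ℤₚ.m-n≡m⊖n m n | ℤₚ.⊖-< m<n with n ∸ m | ℕₚ.m<n⇒0<n∸m m<n
  ... | suc _ | _ = ≡.refl

  coeffℤ-negative : ∀ f m n → coeffℤ f (-[1+ m ] ℤ.- + n) ≡ 0#
  coeffℤ-negative f m zero    = ≡.refl
  coeffℤ-negative f m (suc n) = ≡.refl

  cZ≡coeffℤ : ∀ a q z → cZ a q z ≡ coeffℤ (infCoeff a q) z
  cZ≡coeffℤ a q (+ n)    = ≡.refl
  cZ≡coeffℤ a q -[1+ n ] = ≡.refl

  substPow-⊛-coeff : ∀ f g q .{{_ : NonZero q}} N {m} → m ℕ.< N ℕ.* q →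
    (substPow f q ⊛ g) m ≈ sumTo N (λ u → f u * coeffℤ g (+ m ℤ.- + (u ℕ.* q)))
  substPow-⊛-coeff f g q N {m} m<Nq = begin
    sumTo (suc m) (λ x → substPow f q x * g (m ∸ x))
      ≈⟨ sumTo-cong (suc m) (λ x x<1+m → *-congˡ (reflexive (≡.sym (coeffℤ-∸ g (ℕₚ.≤-pred x<1+m))))) ⟩
    sumTo (suc m) h               ≈⟨ sumTo-extend m<Nq beyond ⟨
    sumTo (N ℕ.* q) h             ≈⟨ sumTo-multiples N q nonmultiple ⟩
    sumTo N (λ u → h (u ℕ.* q))   ≈⟨ sumTo-cong N (λ u _ → *-congʳ (substPow-multiple f q u)) ⟩
    sumTo N (λ u → f u * coeffℤ g (+ m ℤ.- + (u ℕ.* q))) ∎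
    where
    h : ℕ → Carrier
    h x = substPow f q x * coeffℤ g (+ m ℤ.- + x)
    beyond : ∀ x → suc m ℕ.≤ x → h x ≈ 0#
    beyond x m<x = trans (*-congˡ (reflexive (coeffℤ-< g m<x))) (zeroʳ _)
    nonmultiple : ∀ x → ¬ q ∣ x → h x ≈ 0#
    nonmultiple x q∤x = trans (*-congʳ (substPow-nonmultiple f q q∤x)) (zeroˡ _)

  module InfiniteProduct (q : ℕ) (2≤q : 2 ℕ.≤ q) (a : FPS) (a₀≈1 : a 0 ≈ 1#) where

    instance
      q≢0 : NonZero q
      q≢0 = 2≤⇒nonZero 2≤q

    factor : ℕ → FPS
    factor s = substPow a (q ^ s)

    partial : ℕ → FPS
    partial N = prodTo N factor

    partial-suc : ∀ N → partial (suc N) ≋ a ⊛ substPow (partial N) q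
    partial-suc N k = begin
      partial (suc N) k                                ≈⟨ prodTo-unfoldˡ N factor k ⟩
      (factor 0 ⊛ prodTo N (factor ∘ suc)) k           ≈⟨ ⊛-cong (substPow-1 a) (prodTo-cong N factor-suc) k ⟩
      (a ⊛ prodTo N (λ s → substPow (factor s) q)) k   ≈⟨ ⊛-cong {a} (λ _ → refl) (substPow-prodTo N factor q) k ⟨
      (a ⊛ substPow (partial N) q) k                   ∎
      where
      factor-suc : ∀ s → factor (suc s) ≋ substPow (factor s) q
      factor-suc s = sym ∘ substPow-substPow a (q ^ s) q {{ℕₚ.m^n≢0 q s}}

    partial-suc-below : ∀ N {k} → k ℕ.< q ^ N → partial (suc N) k ≈ partial N k
    partial-suc-below N = ⊛-identityʳ-below (partial N) (q ^ N)
      (trans (substPow-multiple a (q ^ N) {{ℕₚ.m^n≢0 q N}} 0) a₀≈1)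
      (λ _ → substPow-below a (q ^ N)) _

    partial-stable : ∀ {k N} → k ℕ.≤′ N → partial N k ≈ partial k k
    partial-stable ≤′-refl = refl
    partial-stable (≤′-step {N} k≤′N) =
      trans (partial-suc-below N (ℕₚ.≤-<-trans (ℕₚ.≤′⇒≤ k≤′N) (n<m^n 2≤q N))) (partial-stable k≤′N)

    partial≈infCoeff : ∀ {k N} → k ℕ.≤ N → partial N k ≈ infCoeff a q k
    partial≈infCoeff {k} k≤N =
      trans (partial-stable (ℕₚ.≤⇒≤′ k≤N)) (sym (partial-stable {k} (≤′-step ≤′-refl)))

    infCoeff-functional-equation : ∀ m → infCoeff a q m ≈ (substPow (infCoeff a q) q ⊛ a) m
    infCoeff-functional-equation m = begin
      partial (suc m) m                  ≈⟨ partial-suc m m ⟩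
      (a ⊛ substPow (partial m) q) m     ≈⟨ ⊛-comm a _ m ⟩
      (substPow (partial m) q ⊛ a) m     ≈⟨ ⊛-cong-≤ a m (λ x x≤m → substPow-cong-≤ q x (λ k k≤x →
                                              partial≈infCoeff (ℕₚ.≤-trans k≤x x≤m))) ⟩
      (substPow (infCoeff a q) q ⊛ a) m  ∎

    cZ-expansion : ∀ N {z} → z ℤ.< + (N ℕ.* q) →
      cZ a q z ≈ sumTo N (λ u → infCoeff a q u * coeffℤ a (z ℤ.- + (u ℕ.* q)))
    cZ-expansion N {+ m} (+<+ m<Nq) =
      trans (infCoeff-functional-equation m) (substPow-⊛-coeff (infCoeff a q) a q N m<Nq)
    cZ-expansion N { -[1+ m ]} _ =
      sym (sumTo-zero N (λ u _ → trans (*-congˡ (reflexive (coeffℤ-negative a m (u ℕ.* q)))) (zeroʳ _)))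

    cZ-recurrence : ∀ {i} j n → i ℕ.< q →
      cZ a q (+ (q ℕ.* n ℕ.+ i) ℤ.- + j)
        ≈ sumTo (suc n) (λ t → coeffℤ a (+ (q ℕ.* t ℕ.+ i) ℤ.- + j) * cZ a q (+ n ℤ.- + t))
    cZ-recurrence {i} j n i<q = begin
      cZ a q z
        ≈⟨ cZ-expansion (suc n) (ℤₚ.≤-<-trans (ℤₚ.i-j≤i _ (+ j)) (+<+ (q*n+i<[1+n]*q n i<q))) ⟩
      sumTo (suc n) (λ u → infCoeff a q u * coeffℤ a (z ℤ.- + (u ℕ.* q)))
        ≈⟨ sumTo-reverse n _ ⟩
      sumTo (suc n) (λ t → infCoeff a q (n ∸ t) * coeffℤ a (z ℤ.- + ((n ∸ t) ℕ.* q)))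
        ≈⟨ sumTo-cong (suc n) (λ t t<1+n → reindex (ℕₚ.≤-pred t<1+n)) ⟩
      sumTo (suc n) (λ t → coeffℤ a (+ (q ℕ.* t ℕ.+ i) ℤ.- + j) * cZ a q (+ n ℤ.- + t)) ∎
      where
      z : ℤ
      z = + (q ℕ.* n ℕ.+ i) ℤ.- + j
      shift : ∀ {t} → t ℕ.≤ n → z ℤ.- + ((n ∸ t) ℕ.* q) ≡ + (q ℕ.* t ℕ.+ i) ℤ.- + j
      shift {t} t≤n = ≡.trans
        (≡.cong (λ w → w ℤ.- + j ℤ.- + ((n ∸ t) ℕ.* q))
          (≡.trans (≡.cong +_ (q*n+i≡q*t+i+[n∸t]*q q i t≤n)) (ℤₚ.pos-+ (q ℕ.* t ℕ.+ i) _)))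
        (x+y-z-y≡x-z (+ (q ℕ.* t ℕ.+ i)) (+ ((n ∸ t) ℕ.* q)) (+ j))
      reindex : ∀ {t} → t ℕ.≤ n →
        infCoeff a q (n ∸ t) * coeffℤ a (z ℤ.- + ((n ∸ t) ℕ.* q))
          ≈ coeffℤ a (+ (q ℕ.* t ℕ.+ i) ℤ.- + j) * cZ a q (+ n ℤ.- + t)
      reindex {t} t≤n = trans (*-comm _ _) (*-cong
        (reflexive (≡.cong (coeffℤ a) (shift t≤n)))
        (reflexive (≡.sym (≡.trans (cZ≡coeffℤ a q (+ n ℤ.- + t)) (coeffℤ-∸ (infCoeff a q) t≤n)))))

lemma3p1 : ∀ {c ℓ} (R : CommutativeRing c ℓ) → let open Series R in
    (q d k : ℕ) (a : ℕ → Carrier)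
    → 2 ℕ.≤ q
    → 1 ℕ.≤ d
    → (∀ m → d ℕ.< m → a m ≈ 0#)
    → ¬ (a d ≈ 0#)
    → a 0 ≈ 1#
    → q ^ k ℕ.< q ℕ.* d
    → d ℕ.≤ q ^ k
    → (i j : ℕ) → i ℕ.< q → j ℕ.≤ 2 ℕ.* q ^ k
    → ∃ λ (lam : ℕ → Carrier) →
        (n : ℕ) → cZ a q (+ (q ℕ.* n ℕ.+ i) ℤ.- + j)
                    ≈ sumTo (2 ℕ.* q ^ k) (λ t → lam t * cZ a q (+ n ℤ.- + t))
lemma3p1 R q d k a 2≤q 1≤d deg-a _ a₀≈1 _ d≤q^k i j i<q j≤2q^k = lam , recurrence
  where
  open Series R
  open SeriesProperties R
  open InfiniteProduct q 2≤q a a₀≈1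

  lam : ℕ → Carrier
  lam t = coeffℤ a (+ (q ℕ.* t ℕ.+ i) ℤ.- + j)

  recurrence : ∀ n → cZ a q (+ (q ℕ.* n ℕ.+ i) ℤ.- + j) ≈ sumTo (2 ℕ.* q ^ k) (λ t → lam t * cZ a q (+ n ℤ.- + t))
  recurrence n = trans (cZ-recurrence j n i<q) (sumTo-vanishing-tail beyond-n beyond-2q^k)
    where
    beyond-n : ∀ t → suc n ℕ.≤ t → lam t * cZ a q (+ n ℤ.- + t) ≈ 0#
    beyond-n t n<t = trans (*-congˡ (reflexive (≡.trans (cZ≡coeffℤ a q (+ n ℤ.- + t)) (coeffℤ-< (infCoeff a q) n<t))))
                           (zeroʳ _)
    beyond-2q^k : ∀ t → 2 ℕ.* q ^ k ℕ.≤ t → lam t * cZ a q (+ n ℤ.- + t) ≈ 0#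
    beyond-2q^k t 2q^k≤t = trans (*-congʳ (trans (reflexive (coeffℤ-∸ a j≤qt+i)) (deg-a _ d<qt+i∸j))) (zeroˡ _)
      where
      d+j<qt+i : d ℕ.+ j ℕ.< q ℕ.* t ℕ.+ i
      d+j<qt+i = ℕₚ.<-≤-trans (d+j<q*t 2≤q 1≤d d≤q^k j≤2q^k 2q^k≤t) (ℕₚ.m≤m+n (q ℕ.* t) i)
      j≤qt+i : j ℕ.≤ q ℕ.* t ℕ.+ i
      j≤qt+i = ℕₚ.≤-trans (ℕₚ.m≤n+m j (suc d)) d+j<qt+i
      d<qt+i∸j : d ℕ.< q ℕ.* t ℕ.+ i ∸ j
      d<qt+i∸j = ℕₚ.m+n≤o⇒m≤o∸n (suc d) d+j<qt+i
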